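{- Let $r\geq 2$, $t\geq 1$, $n,k$ be positive integers with $n>\frac{rk-t}{r-1}$. Then \[ m(n,k,r,t)\leq m(n-1,k,r,t)+m(n-1,k-1,r,t). \]
   Context: $\binom{[n]}{k}$ is the set of $k$-subsets of $[n]=\{1,\dots,n\}$. A family $\mathcal{F}$ is $r$-wise $t$-intersecting if $|F_1\cap\dots\cap F_r|\geq t$ for all (not necessarily distinct) $F_1,\dots,F_r\in\mathcal{F}$. $m(n,k,r,t)$ is the maximum of $|\mathcal{F}|$ over all $r$-wise $t$-intersecting families $\mathcal{F}\subset\binom{[n]}{k}$. -}

module Defs where

open import Data.Nat using (ℕ; _≤_)
open import Data.Fin using (Fin)
open import Data.Fin.Subset using (Subset; ⋂; ∣_∣)
open import Data.List using (List; tabulate; length)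
open import Data.List.Membership.Propositional using (_∈_)
open import Data.List.Relation.Unary.All using (All)
open import Data.List.Relation.Unary.Unique.Propositional using (Unique)
open import Data.Product using (Σ; _×_)
open import Relation.Binary.PropositionalEquality using (_≡_)

record Family (n : ℕ) : Set where
  constructor family
  field
    members  : List (Subset n)
    distinct : Unique members
open Family public

size : ∀ {n} → Family n → ℕ
size 𝓕 = length (members 𝓕)

Uniform : ∀ {n} → ℕ → Family n → Set
Uniform k 𝓕 = All (λ A → ∣ A ∣ ≡ k) (members 𝓕)

-- r-wise t-intersecting: |F₁ ∩ … ∩ F_r| ≥ t for all (not necessarily
-- distinct) F₁,…,F_r ∈ 𝓕.
RWiseTIntersecting : ∀ {n} → ℕ → ℕ → Family n → Set
RWiseTIntersecting {n} r t 𝓕 =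
  (G : Fin r → Subset n) → (∀ i → G i ∈ members 𝓕) → t ≤ ∣ ⋂ (tabulate G) ∣

Admissible : (n k r t : ℕ) → Family n → Set
Admissible n k r t 𝓕 = Uniform k 𝓕 × RWiseTIntersecting r t 𝓕

-- IsM n k r t m  :  m = m(n,k,r,t), the maximum of |𝓕| over all
-- r-wise t-intersecting 𝓕 ⊂ ([n] choose k)  (attained, and an upper bound).
IsM : (n k r t m : ℕ) → Set
IsM n k r t m =
  Σ (Family n) (λ 𝓕 → Admissible n k r t 𝓕 × size 𝓕 ≡ m)
  × ((𝓕 : Family n) → Admissible n k r t 𝓕 → size 𝓕 ≤ m)

{-# OPTIONS --safe #-}
module Submission where

-- A subset of [n] is a Subset (suc m) whose head records membership of a pivot element 0; dropping the
-- head gives the ground set of size n − 1. The shift towards j replaces every member A ∋ 0 with suc j ∉ A by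
-- (A ∖ {0}) ∪ {suc j} unless that set is already a member. It preserves size, uniformity and the r-wise
-- t-intersecting property and lowers the number of members containing 0, so finitely many shifts give a family
-- in which every such replacement is blocked. Then |𝓕| = |𝓕(0̄)| + |𝓕(0)|, where 𝓕(0̄) (members avoiding 0) is
-- plainly k-uniform and r-wise t-intersecting on [n − 1]. For r members H₁,…,H_r of 𝓕(0) (tails of members
-- containing 0), |⋂ Hᵢ| ≥ t − 1. If two of them miss a common j, moving 0 to j in one of them gives r members
-- of 𝓕 whose intersection avoids 0 and j, hence |⋂ Hᵢ| ≥ t. Otherwise their complements, of size n − k each,
-- are pairwise disjoint in [n − 1] ∖ ⋂ Hᵢ, so r(n − k) ≤ n − t, contradicting (r − 1)n + t > rk.

open import Defs
open import Data.Nat using (ℕ; _≤_; _<_; _+_; _*_; _∸_; zero; suc; z≤n; s≤s; _≤?_)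
open import Data.Nat.Properties
  using (≤-refl; ≤-reflexive; ≤-trans; <-≤-trans; <⇒≱; ≤-pred; n≤1+n; +-comm; +-assoc; +-suc;
         *-distribˡ-+; +-mono-≤; +-monoʳ-≤; +-mono-<-≤; +-mono-≤-<; +-cancelˡ-≤; +-cancelˡ-<;
         m+[n∸m]≡n; m≤o∸n⇒m+n≤o; suc-injective; module ≤-Reasoning)
import Data.Bool.Properties as Bool
open import Data.Fin using (Fin; zero; suc)
open import Data.Fin.Properties using (_≟_; all?; any?; ¬∀⟶∃¬) renaming (suc-injective to Fin-suc-injective)
open import Data.Fin.Subset using (Subset; Side; inside; outside; ⋂; ∣_∣; _∈_; _∉_; _⊆_; ∁; _∩_; _∪_; ⁅_⁆; Empty)
open import Data.Fin.Subset.Properties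
  using (_∈?_; drop-there; drop-∷-Empty; ∈⊤; x∈p∩q⁺; x∈p∩q⁻; x∈p∪q⁺; x∈p∪q⁻; x∈⁅x⁆; x∈⁅y⁆⇒x≡y;
         ∣⁅x⁆∣≡1; ⊆-antisym; p⊆q⇒∣p∣≤∣q∣; p⊂q⇒∣p∣<∣q∣; ∣p∣≤n; ∣p∣≤∣x∷p∣; x∈∁p⇒x∉p; x∉p⇒x∈∁p;
         ∣∁p∣≡n∸∣p∣)
open import Data.Vec using ([]; _∷_; here; there)
open import Data.Vec.Properties using (≡-dec; ∷-injectiveʳ)
open import Data.List using (List; []; _∷_; tabulate; length; map)
open import Data.Nat.ListAction using (sum)
open import Data.List.Properties using (length-map; tabulate-cong)
open import Data.List.Membership.Propositional using (find; lose) renaming (_∈_ to _∈ᴸ_; _∉_ to _∉ᴸ_)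
open import Data.List.Membership.Propositional.Properties using (∈-map⁻)
import Data.List.Membership.DecPropositional as DecMembership
open import Data.List.Relation.Unary.Any using (here; there)
import Data.List.Relation.Unary.Any as Any
open import Data.List.Relation.Unary.All using (All; []; _∷_)
import Data.List.Relation.Unary.All as All
open import Data.List.Relation.Unary.All.Properties using () renaming (map⁺ to All-map⁺)
open import Data.List.Relation.Unary.AllPairs using ([]; _∷_)
open import Data.List.Relation.Unary.Unique.Propositional using (Unique)
open import Data.Empty using (⊥)
open import Data.Product using (Σ; ∃; ∃₂; _×_; _,_; -,_; proj₁; proj₂)
import Data.Product as Product
open import Data.Sum using (_⊎_; inj₁; inj₂; [_,_]′)
open import Function using (_∘_; id)
open import Relation.Nullary using (¬_; Dec; yes; no; contradiction; ¬?; _×-dec_; decidable-stable)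
open import Relation.Unary using (Pred; Decidable)
open import Relation.Binary.PropositionalEquality using (_≡_; _≢_; refl; sym; trans; cong; subst; module ≡-Reasoning)

all-or-counterexample : ∀ {n p} {P : Pred (Fin n) p} → Decidable P → (∀ i → P i) ⊎ ∃ λ i → ¬ P i
all-or-counterexample P? with all? P?
... | yes ∀P = inj₁ ∀P
... | no ¬∀P = inj₂ (¬∀⟶∃¬ _ _ P? ¬∀P)

_≟ˢ_ : ∀ {n} (p q : Subset n) → Dec (p ≡ q)
_≟ˢ_ = ≡-dec Bool._≟_

_∈ᴸ?_ : ∀ {n} (p : Subset n) (L : List (Subset n)) → Dec (p ∈ᴸ L)
_∈ᴸ?_ = DecMembership._∈?_ _≟ˢ_

∣p∪q∣≡∣p∣+∣q∣ : ∀ {n} (p q : Subset n) → Empty (p ∩ q) → ∣ p ∪ q ∣ ≡ ∣ p ∣ + ∣ q ∣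
∣p∪q∣≡∣p∣+∣q∣ []            []            _        = refl
∣p∪q∣≡∣p∣+∣q∣ (inside  ∷ p) (inside  ∷ q) disjoint = contradiction (zero , here) disjoint
∣p∪q∣≡∣p∣+∣q∣ (inside  ∷ p) (outside ∷ q) disjoint = cong suc (∣p∪q∣≡∣p∣+∣q∣ p q (drop-∷-Empty disjoint))
∣p∪q∣≡∣p∣+∣q∣ (outside ∷ p) (inside  ∷ q) disjoint =
  trans (cong suc (∣p∪q∣≡∣p∣+∣q∣ p q (drop-∷-Empty disjoint))) (sym (+-suc ∣ p ∣ ∣ q ∣))
∣p∪q∣≡∣p∣+∣q∣ (outside ∷ p) (outside ∷ q) disjoint = ∣p∪q∣≡∣p∣+∣q∣ p q (drop-∷-Empty disjoint)

x∈p∪⁅y⁆⇒x∈p : ∀ {n} {p : Subset n} {x y} → x ≢ y → x ∈ p ∪ ⁅ y ⁆ → x ∈ p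
x∈p∪⁅y⁆⇒x∈p {p = p} {y = y} x≢y x∈ =
  [ id , (λ x∈⁅y⁆ → contradiction (x∈⁅y⁆⇒x≡y y x∈⁅y⁆) x≢y) ]′ (x∈p∪q⁻ p ⁅ y ⁆ x∈)

∣p∪⁅x⁆∣≡1+∣p∣ : ∀ {n} {p : Subset n} {x} → x ∉ p → ∣ p ∪ ⁅ x ⁆ ∣ ≡ suc ∣ p ∣
∣p∪⁅x⁆∣≡1+∣p∣ {p = p} {x} x∉p = begin
  ∣ p ∪ ⁅ x ⁆ ∣      ≡⟨ ∣p∪q∣≡∣p∣+∣q∣ p ⁅ x ⁆ disjoint ⟩
  ∣ p ∣ + ∣ ⁅ x ⁆ ∣  ≡⟨ cong (∣ p ∣ +_) (∣⁅x⁆∣≡1 x) ⟩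
  ∣ p ∣ + 1          ≡⟨ +-comm ∣ p ∣ 1 ⟩
  suc ∣ p ∣          ∎
  where
  open ≡-Reasoning
  disjoint : Empty (p ∩ ⁅ x ⁆)
  disjoint (y , y∈) = let y∈p , y∈⁅x⁆ = x∈p∩q⁻ p ⁅ x ⁆ y∈ in x∉p (subst (_∈ p) (x∈⁅y⁆⇒x≡y x y∈⁅x⁆) y∈p)

∪⁅x⁆-injective : ∀ {n} {p q : Subset n} {x} → x ∉ p → x ∉ q → p ∪ ⁅ x ⁆ ≡ q ∪ ⁅ x ⁆ → p ≡ q
∪⁅x⁆-injective x∉p x∉q eq = ⊆-antisym (⊆-from x∉p eq) (⊆-from x∉q (sym eq))
  where
  ⊆-from : ∀ {n} {p q : Subset n} {x} → x ∉ p → p ∪ ⁅ x ⁆ ≡ q ∪ ⁅ x ⁆ → p ⊆ q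
  ⊆-from x∉p eq y∈p = x∈p∪⁅y⁆⇒x∈p (λ { refl → x∉p y∈p }) (subst (_ ∈_) eq (x∈p∪q⁺ (inj₁ y∈p)))

∣p∣≤∣q∣-by-tail⊂ : ∀ {n} {p q : Subset (suc n)} {x : Fin n} →
  (∀ {y} → suc y ∈ p → suc y ∈ q) → suc x ∈ q → suc x ∉ p → ∣ p ∣ ≤ ∣ q ∣
∣p∣≤∣q∣-by-tail⊂ {p = a ∷ p} {b ∷ q} {x} tail⊆ x∈q x∉p = begin
  ∣ a ∷ p ∣  ≤⟨ ∣s∷p∣≤1+∣p∣ a ⟩
  suc ∣ p ∣  ≤⟨ p⊂q⇒∣p∣<∣q∣ ((λ y∈p → drop-there (tail⊆ (there y∈p))) , x , drop-there x∈q , x∉p ∘ there) ⟩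
  ∣ q ∣      ≤⟨ ∣p∣≤∣x∷p∣ b q ⟩
  ∣ b ∷ q ∣  ∎
  where
  open ≤-Reasoning
  ∣s∷p∣≤1+∣p∣ : ∀ s → ∣ s ∷ p ∣ ≤ suc ∣ p ∣
  ∣s∷p∣≤1+∣p∣ inside  = ≤-refl
  ∣s∷p∣≤1+∣p∣ outside = n≤1+n ∣ p ∣

x∈⋂⁺ : ∀ {n r} {x : Fin n} (G : Fin r → Subset n) → (∀ i → x ∈ G i) → x ∈ ⋂ (tabulate G)
x∈⋂⁺ {r = zero}  G x∈G = ∈⊤
x∈⋂⁺ {r = suc r} G x∈G = x∈p∩q⁺ (x∈G zero , x∈⋂⁺ (G ∘ suc) (x∈G ∘ suc))

x∈⋂⁻ : ∀ {n r} {x : Fin n} (G : Fin r → Subset n) → x ∈ ⋂ (tabulate G) → ∀ i → x ∈ G i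
x∈⋂⁻ {r = suc r} G x∈ zero    = proj₁ (x∈p∩q⁻ (G zero) _ x∈)
x∈⋂⁻ {r = suc r} G x∈ (suc i) = x∈⋂⁻ (G ∘ suc) (proj₂ (x∈p∩q⁻ (G zero) _ x∈)) i

∁p∪∁q⊆∁[p∩q] : ∀ {n} {p q : Subset n} → ∁ p ∪ ∁ q ⊆ ∁ (p ∩ q)
∁p∪∁q⊆∁[p∩q] {p = p} {q} x∈ = x∉p⇒x∈∁p λ x∈p∩q →
  let x∈p , x∈q = x∈p∩q⁻ p q x∈p∩q
  in [ (λ x∈∁p → x∈∁p⇒x∉p x∈∁p x∈p) , (λ x∈∁q → x∈∁p⇒x∉p x∈∁q x∈q) ]′ (x∈p∪q⁻ (∁ p) (∁ q) x∈)

-- The last hypothesis says that the complements ∁ (H i) are pairwise disjoint.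
r*c≤∣∁⋂∣ : ∀ {n r c} (H : Fin r → Subset n) → (∀ i → c ≤ ∣ ∁ (H i) ∣) →
  (∀ {x} i₁ i₂ → i₁ ≢ i₂ → x ∉ H i₁ → x ∈ H i₂) → r * c ≤ ∣ ∁ (⋂ (tabulate H)) ∣
r*c≤∣∁⋂∣ {r = zero} H _ _ = z≤n
r*c≤∣∁⋂∣ {r = suc r} {c} H c≤∣∁H∣ codisjoint = begin
  c + r * c                 ≤⟨ +-mono-≤ (c≤∣∁H∣ zero) (r*c≤∣∁⋂∣ (H ∘ suc) (c≤∣∁H∣ ∘ suc) codisjoint-suc) ⟩
  ∣ ∁ (H zero) ∣ + ∣ ∁ I ∣  ≡⟨ sym (∣p∪q∣≡∣p∣+∣q∣ (∁ (H zero)) (∁ I) disjoint) ⟩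
  ∣ ∁ (H zero) ∪ ∁ I ∣      ≤⟨ p⊆q⇒∣p∣≤∣q∣ (∁p∪∁q⊆∁[p∩q] {p = H zero} {I}) ⟩
  ∣ ∁ (H zero ∩ I) ∣        ∎
  where
  open ≤-Reasoning
  I : Subset _
  I = ⋂ (tabulate (H ∘ suc))
  codisjoint-suc : ∀ {x} i₁ i₂ → i₁ ≢ i₂ → x ∉ H (suc i₁) → x ∈ H (suc i₂)
  codisjoint-suc i₁ i₂ i₁≢i₂ = codisjoint (suc i₁) (suc i₂) (i₁≢i₂ ∘ Fin-suc-injective)
  disjoint : Empty (∁ (H zero) ∩ ∁ I)
  disjoint (x , x∈) =
    let x∈∁H₀ , x∈∁I = x∈p∩q⁻ (∁ (H zero)) (∁ I) x∈
    in x∈∁p⇒x∉p x∈∁I (x∈⋂⁺ (H ∘ suc) λ i → codisjoint zero (suc i) (λ ()) (x∈∁p⇒x∉p x∈∁H₀))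

too-many-complements : ∀ {r k m X t} → k ≤ m → X ≤ m →
  suc r * suc k < r * suc m + t → t ≤ suc X → suc r * (m ∸ k) ≤ m ∸ X → ⊥
too-many-complements {r} {k} {m} {X} {t} k≤m X≤m large t≤1+X count = <⇒≱ k<rd+X rd+X≤k
  where
  open ≤-Reasoning
  d : ℕ
  d = m ∸ k
  m≡k+d : m ≡ k + d
  m≡k+d = sym (m+[n∸m]≡n k≤m)
  1+k<rd+1+X : suc k < r * d + suc X
  1+k<rd+1+X = +-cancelˡ-< (r * suc k) (suc k) (r * d + suc X) (begin-strict
    r * suc k + suc k            ≡⟨ +-comm (r * suc k) (suc k) ⟩
    suc r * suc k                <⟨ large ⟩
    r * suc m + t                ≤⟨ +-monoʳ-≤ (r * suc m) t≤1+X ⟩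
    r * suc m + suc X            ≡⟨ cong (λ n → r * suc n + suc X) m≡k+d ⟩
    r * (suc k + d) + suc X      ≡⟨ cong (_+ suc X) (*-distribˡ-+ r (suc k) d) ⟩
    r * suc k + r * d + suc X    ≡⟨ +-assoc (r * suc k) (r * d) (suc X) ⟩
    r * suc k + (r * d + suc X)  ∎)
  k<rd+X : k < r * d + X
  k<rd+X = ≤-pred (subst (suc (suc k) ≤_) (+-suc (r * d) X) 1+k<rd+1+X)
  rd+X≤k : r * d + X ≤ k
  rd+X≤k = +-cancelˡ-≤ d (r * d + X) k (begin
    d + (r * d + X)  ≡⟨ sym (+-assoc d (r * d) X) ⟩
    suc r * d + X    ≤⟨ m≤o∸n⇒m+n≤o (suc r * d) X≤m count ⟩
    m                ≡⟨ m≡k+d ⟩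
    k + d            ≡⟨ +-comm k d ⟩
    d + k            ∎)

tailsWithHead : ∀ {m} → Side → List (Subset (suc m)) → List (Subset m)
tailsWithHead s [] = []
tailsWithHead s ((s′ ∷ u) ∷ L) with s′ Bool.≟ s
... | yes _ = u ∷ tailsWithHead s L
... | no  _ = tailsWithHead s L

∈-tailsWithHead⁻ : ∀ {m s} {u : Subset m} L → u ∈ᴸ tailsWithHead s L → (s ∷ u) ∈ᴸ L
∈-tailsWithHead⁻ {s = s} ((s′ ∷ v) ∷ L) u∈ with s′ Bool.≟ s | u∈
... | yes refl | here refl = here refl
... | yes refl | there u∈′ = there (∈-tailsWithHead⁻ L u∈′)
... | no  _    | u∈′       = there (∈-tailsWithHead⁻ L u∈′)

tailsWithHead-All : ∀ {m s p} {P : Pred (Subset (suc m)) p} {L} → All P L → All (P ∘ (s ∷_)) (tailsWithHead s L)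
tailsWithHead-All [] = []
tailsWithHead-All {s = s} {L = (s′ ∷ u) ∷ L} (Pu ∷ PL) with s′ Bool.≟ s
... | yes refl = Pu ∷ tailsWithHead-All PL
... | no  _    = tailsWithHead-All PL

tailsWithHead-unique : ∀ {m s} {L : List (Subset (suc m))} → Unique L → Unique (tailsWithHead s L)
tailsWithHead-unique [] = []
tailsWithHead-unique {s = s} {L = (s′ ∷ u) ∷ L} (u∉L ∷ L-unique) with s′ Bool.≟ s
... | yes refl =
  All.map (λ s∷u≢s∷v → s∷u≢s∷v ∘ cong (s ∷_)) (tailsWithHead-All u∉L) ∷ tailsWithHead-unique L-unique
... | no  _    = tailsWithHead-unique L-unique

length-tailsWithHead : ∀ {m} (L : List (Subset (suc m))) →
  length L ≡ length (tailsWithHead outside L) + length (tailsWithHead inside L)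
length-tailsWithHead [] = refl
length-tailsWithHead ((outside ∷ u) ∷ L) = cong suc (length-tailsWithHead L)
length-tailsWithHead ((inside  ∷ u) ∷ L) =
  trans (cong suc (length-tailsWithHead L)) (sym (+-suc (length (tailsWithHead outside L)) _))

section : ∀ {m} → Side → Family (suc m) → Family m
section s 𝓕 = family (tailsWithHead s (members 𝓕)) (tailsWithHead-unique (distinct 𝓕))

size-sections : ∀ {m} (𝓕 : Family (suc m)) → size 𝓕 ≡ size (section outside 𝓕) + size (section inside 𝓕)
size-sections 𝓕 = length-tailsWithHead (members 𝓕)

section-outside-uniform : ∀ {m k} (𝓕 : Family (suc m)) → Uniform k 𝓕 → Uniform k (section outside 𝓕)
section-outside-uniform 𝓕 = tailsWithHead-All

section-inside-uniform : ∀ {m k} (𝓕 : Family (suc m)) → Uniform (suc k) 𝓕 → Uniform k (section inside 𝓕)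
section-inside-uniform 𝓕 = All.map suc-injective ∘ tailsWithHead-All

section-outside-rwise : ∀ {m r t} (𝓕 : Family (suc m)) →
  RWiseTIntersecting (suc r) t 𝓕 → RWiseTIntersecting (suc r) t (section outside 𝓕)
section-outside-rwise {m} {r} 𝓕 intersecting H H∈ =
  ≤-trans (intersecting G (∈-tailsWithHead⁻ _ ∘ H∈)) (p⊆q⇒∣p∣≤∣q∣ ⋂G⊆)
  where
  G : Fin (suc r) → Subset (suc m)
  G i = outside ∷ H i
  ⋂G⊆ : ⋂ (tabulate G) ⊆ outside ∷ ⋂ (tabulate H)
  ⋂G⊆ {zero}  0∈ = contradiction (x∈⋂⁻ G 0∈ zero) λ ()
  ⋂G⊆ {suc y} y∈ = there (x∈⋂⁺ H λ i → drop-there (x∈⋂⁻ G y∈ i))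

-- For the set A = inside ∷ u, which contains 0, move j u is (A ∖ {0}) ∪ {suc j}.
move : ∀ {m} → Fin m → Subset m → Subset (suc m)
move j u = outside ∷ (u ∪ ⁅ j ⁆)

Shifted : ∀ {m} → Family (suc m) → Set
Shifted {m} 𝓕 = ∀ {u} → u ∈ᴸ members (section inside 𝓕) → (j : Fin m) → j ∉ u → move j u ∈ᴸ members 𝓕

common-gap⇒t≤∣⋂∣ : ∀ {m r t} (𝓕 : Family (suc m)) → Shifted 𝓕 → RWiseTIntersecting r t 𝓕 →
  (H : Fin r → Subset m) → (∀ i → H i ∈ᴸ members (section inside 𝓕)) →
  ∀ {j i₁ i₂} → i₁ ≢ i₂ → j ∉ H i₁ → j ∉ H i₂ → t ≤ ∣ ⋂ (tabulate H) ∣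
common-gap⇒t≤∣⋂∣ {m} {r} 𝓕 shifted intersecting H H∈ {j} {i₁} {i₂} i₁≢i₂ j∉H₁ j∉H₂ =
  ≤-trans (intersecting G (λ i → G′∈ i (i ≟ i₁))) (p⊆q⇒∣p∣≤∣q∣ ⋂G⊆)
  where
  G′ : ∀ i → Dec (i ≡ i₁) → Subset (suc m)
  G′ i (yes _) = move j (H i₁)
  G′ i (no _)  = inside ∷ H i
  G : Fin r → Subset (suc m)
  G i = G′ i (i ≟ i₁)
  G′∈ : ∀ i d → G′ i d ∈ᴸ members 𝓕
  G′∈ i (yes _) = shifted (H∈ i₁) j j∉H₁
  G′∈ i (no _)  = ∈-tailsWithHead⁻ _ (H∈ i)
  G′-tail : ∀ i d {y} → y ≢ j → suc y ∈ G′ i d → y ∈ H i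
  G′-tail i (yes refl) y≢j (there y∈) = x∈p∪⁅y⁆⇒x∈p y≢j y∈
  G′-tail i (no _)     _   (there y∈) = y∈
  0∉G′₁ : ∀ d → zero ∉ G′ i₁ d
  0∉G′₁ (yes _)    ()
  0∉G′₁ (no i₁≢i₁) _ = i₁≢i₁ refl
  j∉G′₂ : ∀ d → suc j ∉ G′ i₂ d
  j∉G′₂ (yes i₂≡i₁) _          = i₁≢i₂ (sym i₂≡i₁)
  j∉G′₂ (no _)      (there j∈) = j∉H₂ j∈
  ⋂G⊆ : ⋂ (tabulate G) ⊆ outside ∷ ⋂ (tabulate H)
  ⋂G⊆ {zero}  0∈ = contradiction (x∈⋂⁻ G 0∈ i₁) (0∉G′₁ _)
  ⋂G⊆ {suc y} y∈ = there (x∈⋂⁺ H λ i → G′-tail i _ y≢j (x∈⋂⁻ G y∈ i))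
    where
    y≢j : y ≢ j
    y≢j refl = j∉G′₂ _ (x∈⋂⁻ G y∈ i₂)

section-inside-rwise : ∀ {m k r t} (𝓕 : Family (suc m)) → Shifted 𝓕 → Uniform (suc k) 𝓕 →
  RWiseTIntersecting (suc r) t 𝓕 → suc r * suc k < r * suc m + t →
  RWiseTIntersecting (suc r) t (section inside 𝓕)
section-inside-rwise {m} {k} {r} {t} 𝓕 shifted uniform intersecting large H H∈ =
  decidable-stable (t ≤? X) λ t≰X →
    too-many-complements {r} k≤m (∣p∣≤n (⋂ (tabulate H))) large t≤1+X (count (codisjoint t≰X))
  where
  X : ℕ
  X = ∣ ⋂ (tabulate H) ∣
  G : Fin (suc r) → Subset (suc m)
  G i = inside ∷ H i
  ⋂G⊆ : ⋂ (tabulate G) ⊆ inside ∷ ⋂ (tabulate H)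
  ⋂G⊆ {zero}  _  = here
  ⋂G⊆ {suc y} y∈ = there (x∈⋂⁺ H λ i → drop-there (x∈⋂⁻ G y∈ i))
  t≤1+X : t ≤ suc X
  t≤1+X = ≤-trans (intersecting G (∈-tailsWithHead⁻ _ ∘ H∈)) (p⊆q⇒∣p∣≤∣q∣ ⋂G⊆)
  ∣H∣≡k : ∀ i → ∣ H i ∣ ≡ k
  ∣H∣≡k i = All.lookup (section-inside-uniform 𝓕 uniform) (H∈ i)
  k≤m : k ≤ m
  k≤m = subst (_≤ m) (∣H∣≡k zero) (∣p∣≤n (H zero))
  codisjoint : ¬ t ≤ X → ∀ {x} i₁ i₂ → i₁ ≢ i₂ → x ∉ H i₁ → x ∈ H i₂
  codisjoint t≰X {x} i₁ i₂ i₁≢i₂ x∉H₁ = decidable-stable (x ∈? H i₂) λ x∉H₂ →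
    t≰X (common-gap⇒t≤∣⋂∣ 𝓕 shifted intersecting H H∈ i₁≢i₂ x∉H₁ x∉H₂)
  ∣∁H∣≡m∸k : ∀ i → ∣ ∁ (H i) ∣ ≡ m ∸ k
  ∣∁H∣≡m∸k i = trans (∣∁p∣≡n∸∣p∣ (H i)) (cong (m ∸_) (∣H∣≡k i))
  count : (∀ {x} i₁ i₂ → i₁ ≢ i₂ → x ∉ H i₁ → x ∈ H i₂) → suc r * (m ∸ k) ≤ m ∸ X
  count codisjoint′ = subst (suc r * (m ∸ k) ≤_) (∣∁p∣≡n∸∣p∣ (⋂ (tabulate H)))
    (r*c≤∣∁⋂∣ H (≤-reflexive ∘ sym ∘ ∣∁H∣≡m∸k) codisjoint′)

pivot : ∀ {m} → Subset (suc m) → ℕ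
pivot (inside  ∷ _) = 1
pivot (outside ∷ _) = 0

pivotCount : ∀ {m} → List (Subset (suc m)) → ℕ
pivotCount = sum ∘ map pivot

module Shift {m : ℕ} (j : Fin m) (𝓕 : Family (suc m)) where

  L : List (Subset (suc m))
  L = members 𝓕

  data Fixed : Subset (suc m) → Set where
    without-0 : ∀ {u} → Fixed (outside ∷ u)
    with-j    : ∀ {u} → j ∈ u → Fixed (inside ∷ u)
    blocked   : ∀ {u} → j ∉ u → move j u ∈ᴸ L → Fixed (inside ∷ u)

  data ShiftView : Subset (suc m) → Subset (suc m) → Set where
    fixed : ∀ {A} → Fixed A → ShiftView A A
    moved : ∀ {u} → j ∉ u → move j u ∉ᴸ L → ShiftView (inside ∷ u) (move j u)

  shiftView : (A : Subset (suc m)) → ∃ (ShiftView A)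
  shiftView (outside ∷ u) = -, fixed without-0
  shiftView (inside ∷ u) with j ∈? u | move j u ∈ᴸ? L
  ... | yes j∈u | _       = -, fixed (with-j j∈u)
  ... | no  j∉u | yes m∈L = -, fixed (blocked j∉u m∈L)
  ... | no  j∉u | no  m∉L = -, moved j∉u m∉L

  shift : Subset (suc m) → Subset (suc m)
  shift A = proj₁ (shiftView A)

  view : ∀ A → ShiftView A (shift A)
  view A = proj₂ (shiftView A)

  views-injective : ∀ {A A′ B B′} → A ∈ᴸ L → B ∈ᴸ L → ShiftView A A′ → ShiftView B B′ → A′ ≡ B′ → A ≡ B
  views-injective _   _   (fixed _)     (fixed _)     eq   = eq
  views-injective A∈L _   (fixed _)     (moved _ m∉L) refl = contradiction A∈L m∉L
  views-injective _   B∈L (moved _ m∉L) (fixed _)     refl = contradiction B∈L m∉L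
  views-injective _   _   (moved j∉u _) (moved j∉v _) eq   =
    cong (inside ∷_) (∪⁅x⁆-injective j∉u j∉v (∷-injectiveʳ eq))

  map-shift-unique : ∀ {M} → All (_∈ᴸ L) M → Unique M → Unique (map shift M)
  map-shift-unique [] [] = []
  map-shift-unique {A ∷ M} (A∈L ∷ M⊆L) (A∉M ∷ M-unique) =
    All-map⁺ (All.zipWith (λ {B} (B∈L , A≢B) → A≢B ∘ views-injective A∈L B∈L (view A) (view B)) (M⊆L , A∉M))
    ∷ map-shift-unique M⊆L M-unique

  shiftFamily : Family (suc m)
  shiftFamily = family (map shift L) (map-shift-unique (All.tabulate id) (distinct 𝓕))

  size-shiftFamily : size shiftFamily ≡ size 𝓕
  size-shiftFamily = length-map shift L

  view-size : ∀ {A B} → ShiftView A B → ∣ B ∣ ≡ ∣ A ∣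
  view-size (fixed _)     = refl
  view-size (moved j∉u _) = ∣p∪⁅x⁆∣≡1+∣p∣ j∉u

  shift-uniform : ∀ {k} → Uniform k 𝓕 → Uniform k shiftFamily
  shift-uniform = All-map⁺ ∘ All.map (λ {A} → trans (view-size (view A)))

  view-pivot : ∀ {A B} → ShiftView A B → pivot B ≤ pivot A
  view-pivot (fixed without-0)      = ≤-refl
  view-pivot (fixed (with-j _))     = ≤-refl
  view-pivot (fixed (blocked _ _))  = ≤-refl
  view-pivot (moved _ _)            = z≤n

  moved-pivot : ∀ {u B} → ShiftView (inside ∷ u) B → j ∉ u → move j u ∉ᴸ L → pivot B < 1
  moved-pivot (fixed (with-j j∈u))    j∉u _   = contradiction j∈u j∉u
  moved-pivot (fixed (blocked _ m∈L)) _   m∉L = contradiction m∈L m∉L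
  moved-pivot (moved _ _)             _   _   = s≤s z≤n

  pivotCount-map-shift-≤ : ∀ M → pivotCount (map shift M) ≤ pivotCount M
  pivotCount-map-shift-≤ []      = z≤n
  pivotCount-map-shift-≤ (A ∷ M) = +-mono-≤ (view-pivot (view A)) (pivotCount-map-shift-≤ M)

  pivotCount-map-shift-< : ∀ {u M} → inside ∷ u ∈ᴸ M → j ∉ u → move j u ∉ᴸ L →
    pivotCount (map shift M) < pivotCount M
  pivotCount-map-shift-< {M = A ∷ M} (here refl) j∉u m∉L =
    +-mono-<-≤ (moved-pivot (view A) j∉u m∉L) (pivotCount-map-shift-≤ M)
  pivotCount-map-shift-< {M = A ∷ M} (there u∈) j∉u m∉L =
    +-mono-≤-< (view-pivot (view A)) (pivotCount-map-shift-< u∈ j∉u m∉L)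

  view-tail : ∀ {A B} → ShiftView A B → ∀ {y} → suc y ∈ A → suc y ∈ B
  view-tail (fixed _)   y∈         = y∈
  view-tail (moved _ _) (there y∈) = there (x∈p∪q⁺ (inj₁ y∈))

  -- Stands in for the preimage A when the shifted sets miss suc j: it lies in L, agrees with B off
  -- {0, suc j}, and avoids 0 whenever B avoids suc j.
  partner : ∀ {A B} → ShiftView A B → Subset (suc m)
  partner {A} (fixed without-0)         = A
  partner {A} (fixed (with-j _))        = A
  partner     (fixed (blocked {u} _ _)) = move j u
  partner {A} (moved _ _)               = A

  partner-∈ : ∀ {A B} (v : ShiftView A B) → A ∈ᴸ L → partner v ∈ᴸ L
  partner-∈ (fixed without-0)       A∈L = A∈L
  partner-∈ (fixed (with-j _))      A∈L = A∈L
  partner-∈ (fixed (blocked _ m∈L)) _   = m∈L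
  partner-∈ (moved _ _)             A∈L = A∈L

  partner-tail : ∀ {A B} (v : ShiftView A B) {y} → y ≢ j → suc y ∈ partner v → suc y ∈ B
  partner-tail (fixed without-0)     _   y∈         = y∈
  partner-tail (fixed (with-j _))    _   y∈         = y∈
  partner-tail (fixed (blocked _ _)) y≢j (there y∈) = there (x∈p∪⁅y⁆⇒x∈p y≢j y∈)
  partner-tail (moved _ _)           _   (there y∈) = there (x∈p∪q⁺ (inj₁ y∈))

  partner-avoids-0 : ∀ {A B} (v : ShiftView A B) → suc j ∉ B → zero ∉ partner v
  partner-avoids-0 (fixed without-0)     _   ()
  partner-avoids-0 (fixed (with-j j∈u))  j∉B _ = j∉B (there j∈u)
  partner-avoids-0 (fixed (blocked _ _)) _   ()
  partner-avoids-0 (moved _ _)           j∉B _ = j∉B (there (x∈p∪q⁺ (inj₂ (x∈⁅x⁆ j))))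

  moving-avoids-j : ∀ {A B} (v : ShiftView A B) → B ≢ A → suc j ∉ A × suc j ∉ partner v
  moving-avoids-j (fixed _)     B≢A = contradiction refl B≢A
  moving-avoids-j (moved j∉u _) _   = j∉u ∘ drop-there , j∉u ∘ drop-there

  views-rwise : ∀ {r t} → RWiseTIntersecting r t 𝓕 → (F G : Fin r → Subset (suc m)) →
    (∀ i → F i ∈ᴸ L) → (∀ i → ShiftView (F i) (G i)) → t ≤ ∣ ⋂ (tabulate G) ∣
  views-rwise {r} {t} intersecting F G F∈ V with all-or-counterexample (λ i → G i ≟ˢ F i)
  ... | inj₁ G≡F = subst (λ Gs → t ≤ ∣ ⋂ Gs ∣) (tabulate-cong (sym ∘ G≡F)) (intersecting F F∈)
  ... | inj₂ (i₁ , G≢F) with all-or-counterexample (λ i → suc j ∈? G i)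
  ...   | inj₁ j∈G = ≤-trans (intersecting F F∈)
            (∣p∣≤∣q∣-by-tail⊂ (λ y∈ → x∈⋂⁺ G λ i → view-tail (V i) (x∈⋂⁻ F y∈ i)) (x∈⋂⁺ G j∈G)
              (λ j∈ → proj₁ (moving-avoids-j (V i₁) G≢F) (x∈⋂⁻ F j∈ i₁)))
  ...   | inj₂ (i₂ , j∉G) = ≤-trans (intersecting K (λ i → partner-∈ (V i) (F∈ i))) (p⊆q⇒∣p∣≤∣q∣ ⋂K⊆⋂G)
    where
    K : Fin r → Subset (suc m)
    K i = partner (V i)
    ⋂K⊆⋂G : ⋂ (tabulate K) ⊆ ⋂ (tabulate G)
    ⋂K⊆⋂G {zero}  0∈ = contradiction (x∈⋂⁻ K 0∈ i₂) (partner-avoids-0 (V i₂) j∉G)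
    ⋂K⊆⋂G {suc y} y∈ = x∈⋂⁺ G λ i → partner-tail (V i) y≢j (x∈⋂⁻ K y∈ i)
      where
      y≢j : y ≢ j
      y≢j refl = proj₂ (moving-avoids-j (V i₁) G≢F) (x∈⋂⁻ K y∈ i₁)

  shift-rwise : ∀ {r t} → RWiseTIntersecting r t 𝓕 → RWiseTIntersecting r t shiftFamily
  shift-rwise {r} intersecting G G∈ = views-rwise intersecting F G F∈ V
    where
    preimage : ∀ i → ∃ λ A → A ∈ᴸ L × G i ≡ shift A
    preimage i = ∈-map⁻ shift (G∈ i)
    F : Fin r → Subset (suc m)
    F i = proj₁ (preimage i)
    F∈ : ∀ i → F i ∈ᴸ L
    F∈ i = proj₁ (proj₂ (preimage i))
    V : ∀ i → ShiftView (F i) (G i)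
    V i = subst (ShiftView (F i)) (sym (proj₂ (proj₂ (preimage i)))) (view (F i))

shifted-or-violated : ∀ {m} (𝓕 : Family (suc m)) →
  Shifted 𝓕 ⊎ ∃₂ λ u j → u ∈ᴸ members (section inside 𝓕) × j ∉ u × move j u ∉ᴸ members 𝓕
shifted-or-violated 𝓕 with Any.any? (λ u → any? λ j → ¬? (j ∈? u) ×-dec ¬? (move j u ∈ᴸ? members 𝓕))
                                    (members (section inside 𝓕))
... | yes violation = let u , u∈ , j , j∉u , m∉𝓕 = find violation in inj₂ (u , j , u∈ , j∉u , m∉𝓕)
... | no  ¬violation = inj₁ λ u∈ j j∉u →
  decidable-stable (move j _ ∈ᴸ? members 𝓕) λ m∉𝓕 → ¬violation (lose u∈ (j , j∉u , m∉𝓕))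

shift-until-shifted : ∀ {m k r t} bound (𝓕 : Family (suc m)) → pivotCount (members 𝓕) < bound →
  Admissible (suc m) k r t 𝓕 →
  Σ (Family (suc m)) λ 𝓖 → Shifted 𝓖 × Admissible (suc m) k r t 𝓖 × size 𝓖 ≡ size 𝓕
shift-until-shifted (suc bound) 𝓕 (s≤s pivotCount≤bound) admissible with shifted-or-violated 𝓕
... | inj₁ shifted = 𝓕 , shifted , admissible , refl
... | inj₂ (u , j , u∈ , j∉u , m∉𝓕) =
  let 𝓖 , shifted , admissible′ , size≡ =
        shift-until-shifted bound shiftFamily
          (<-≤-trans (pivotCount-map-shift-< {M = members 𝓕} (∈-tailsWithHead⁻ _ u∈) j∉u m∉𝓕) pivotCount≤bound)
          (Product.map shift-uniform shift-rwise admissible)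
  in 𝓖 , shifted , admissible′ , trans size≡ size-shiftFamily
  where open Shift j 𝓕

shifted-version : ∀ {m k r t} (𝓕 : Family (suc m)) → Admissible (suc m) k r t 𝓕 →
  Σ (Family (suc m)) λ 𝓖 → Shifted 𝓖 × Admissible (suc m) k r t 𝓖 × size 𝓖 ≡ size 𝓕
shifted-version 𝓕 = shift-until-shifted _ 𝓕 ≤-refl

lemma6p1 : (n k r t : ℕ) → 2 ≤ r → 1 ≤ t → 1 ≤ n → 1 ≤ k
    → r * k < (r ∸ 1) * n + t
    → (a b c : ℕ)
    → IsM n k r t a → IsM (n ∸ 1) k r t b → IsM (n ∸ 1) (k ∸ 1) r t c
    → a ≤ b + c
lemma6p1 zero    _       _       _ _  _ () _  _ _ _ _ _ _ _
lemma6p1 (suc m) zero    _       _ _  _ _  () _ _ _ _ _ _ _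
lemma6p1 (suc m) (suc k) zero    _ () _ _  _  _ _ _ _ _ _ _
lemma6p1 (suc m) (suc k) (suc r) t _  _ _  _  large _ b c
  ((𝓕 , admissible , refl) , _) (_ , b-max) (_ , c-max) with shifted-version 𝓕 admissible
... | 𝓖 , shifted , (uniform , intersecting) , size≡ = begin
  size 𝓕                                               ≡⟨ sym size≡ ⟩
  size 𝓖                                               ≡⟨ size-sections 𝓖 ⟩
  size (section outside 𝓖) + size (section inside 𝓖)  ≤⟨ +-mono-≤ outside-bound inside-bound ⟩
  b + c                                                ∎
  where
  open ≤-Reasoning
  outside-bound : size (section outside 𝓖) ≤ b
  outside-bound = b-max (section outside 𝓖)
    (section-outside-uniform 𝓖 uniform , section-outside-rwise 𝓖 intersecting)
  inside-bound : size (section inside 𝓖) ≤ c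
  inside-bound = c-max (section inside 𝓖)
    (section-inside-uniform 𝓖 uniform , section-inside-rwise 𝓖 shifted uniform intersecting large)
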